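{- For every integer $n\ge 1$, the number $r_{n+1}$ of rooted duplication trees with $n+1$ leaves equals the number $\sigma_n$ of counter arrays of length $n$: $r_{n+1}=\sigma_n$.
   Context: A counter array of length $n$ is an integer array $(a_1,\dots,a_n)$ such that $1\le a_i\le i$ for all $1\le i\le n$ and $a_{i+1}\ge a_i-1$ for all $1\le i<n$; $\sigma_n$ is the number of such arrays. Tandem duplication event: given an ordered sequence of genes $(g_1,\dots,g_m)$ and a contiguous block of indices $B=\{i,\dots,i+\ell-1\}$ with $1\le i\le i+\ell-1\le m$, the event replaces $g_i,\dots,g_{i+\ell-1}$ by $\operatorname{lc}(g_i),\dots,\operatorname{lc}(g_{i+\ell-1}),\operatorname{rc}(g_i),\dots,\operatorname{rc}(g_{i+\ell-1})$, where the $\operatorname{lc}(g_j),\operatorname{rc}(g_j)$ are distinct new genes, which become the left and right child of $g_j$. A rooted duplication tree is obtained by starting from the single gene sequence $(1)$ (the root) and applying a finite sequence of duplication events; the tree records the history: each duplicated gene is an internal node with left child $\operatorname{lc}$ and right child $\operatorname{rc}$, and the leaves are the genes of the final sequence, carrying the left-to-right order of that final sequence. Two such trees are identified if they are isomorphic as rooted binary trees with distinguished left/right children and the same left-to-right order of leaves. $r_n$ is the number of distinct rooted duplication trees with $n$ leaves. -}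

module Defs where

open import Data.Nat using (ℕ; zero; suc; _+_; _≤_)
open import Data.Bool using (Bool; true; false)
open import Data.List using (List; []; _∷_; [_]; _++_; map; take; drop; length; foldr)
open import Data.Vec using (Vec; lookup)
open import Data.Fin using (Fin; toℕ)
open import Data.Product using (Σ; ∃; _×_; _,_; proj₂)
open import Data.List.Membership.Propositional using (_∈_)
open import Data.List.Relation.Unary.Unique.Propositional using (Unique)
open import Function.Bundles using (_⇔_)
open import Relation.Binary.PropositionalEquality using (_≡_)

HasCount : {A : Set} → (A → Set) → ℕ → Set
HasCount {A} P k =
  Σ (List A) λ xs → Unique xs × length xs ≡ k × ((x : A) → (x ∈ xs) ⇔ P x)

-- Counter arrays of length n (entries a_1..a_n, stored 0-indexed).
-- Index i : Fin n stands for position toℕ i + 1.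
--   1 ≤ a_i ≤ i,  and  a_{i+1} ≥ a_i - 1  (i.e. a_i ≤ a_{i+1} + 1).

IsCounterArray : (n : ℕ) → Vec ℕ n → Set
IsCounterArray n a =
  ((i : Fin n) → 1 ≤ lookup a i × lookup a i ≤ suc (toℕ i)) ×
  ((i j : Fin n) → toℕ j ≡ suc (toℕ i) → lookup a i ≤ suc (lookup a j))

-- Rooted binary trees with distinguished left/right children.
-- (Isomorphism of such plane trees is just equality.)

data Tree : Set where
  leaf : Tree
  node : Tree → Tree → Tree

-- Address of a node: false = go to left child, true = go to right child.
Path : Set
Path = List Bool

grow : Path → Tree → Tree
grow []          leaf       = node leaf leaf
grow []          (node l r) = node l r
grow (_ ∷ _)     leaf       = leaf
grow (false ∷ p) (node l r) = node (grow p l) r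
grow (true  ∷ p) (node l r) = node l (grow p r)

-- A duplication history state: the tree together with the ordered
-- sequence of its leaves (each leaf identified by its address).
DupState : Set
DupState = Tree × List Path

-- A duplication event on the block of
-- positions i+1, …, i+ℓ (0-based start i, length ℓ ≥ 1) replaces
-- g_{i+1}..g_{i+ℓ} by lc(g_{i+1})..lc(g_{i+ℓ}), rc(g_{i+1})..rc(g_{i+ℓ}).
data Reachable : DupState → Set where
  start : Reachable (leaf , [ [] ])
  dup   : ∀ {t s} → Reachable (t , s) → (i ℓ : ℕ) → 1 ≤ ℓ → i + ℓ ≤ length s →
          Reachable ( foldr grow t (take ℓ (drop i s))
                    , take i s
                      ++ map (λ p → p ++ [ false ]) (take ℓ (drop i s))
                      ++ map (λ p → p ++ [ true ]) (take ℓ (drop i s))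
                      ++ drop (i + ℓ) s )

-- Rooted duplication trees with n leaves (distinct up to isomorphism
-- preserving left/right children and the leaf order = distinct states).
IsRootedDupTree : ℕ → DupState → Set
IsRootedDupTree n x = Reachable x × length (proj₂ x) ≡ n

{-# OPTIONS --safe #-}
module Submission where

-- Duplication events on disjoint blocks commute, so every history can be reordered into a
-- canonical one in which no event's block lies entirely to the left of the previous event's
-- block.  In the leaf sequence of a canonical history the last event is the rightmost place
-- where a run of left children g₁0 … gₖ0 is followed by the matching right children
-- g₁1 … gₖ1; undoing it and recursing shows that a canonical history is determined by its
-- leaf sequence.  A canonical history is written as a counter array by recording, for each
-- event of width ℓ whose block starts at 0-based position j, the entries j+ℓ, j+ℓ−1, …, j+1.
-- Every entry adds one leaf, the first event (duplicating the root) is the forced entry 1,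
-- and the counter-array inequalities are exactly the range and canonicity conditions, so
-- trees with n+1 leaves and counter arrays of length n are in bijection.

open import Defs
open import Data.Bool using (Bool; true; false)
open import Data.Empty using (⊥; ⊥-elim)
open import Data.Fin as Fin using (Fin; toℕ)
open import Data.Fin.Properties using (all?; toℕ<n)
open import Data.List
  using (List; []; _∷_; [_]; _++_; _∷ʳ_; map; take; drop; length; foldr; filter; upTo; cartesianProductWith)
open import Data.List.Membership.Propositional using (_∈_)
open import Data.List.Membership.Propositional.Properties
  using (∈-map⁺; ∈-map⁻; ∈-filter⁺; ∈-filter⁻; ∈-upTo⁺; ∈-cartesianProductWith⁺)
open import Data.List.Properties
  using ( ++-assoc; ++-identityʳ; ++-cancelˡ; ∷-injective; ∷-injectiveˡ; ∷ʳ-injectiveˡ; ∷ʳ-injectiveʳ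
        ; length-++; length-map; map-injective)
open import Data.List.Relation.Unary.All as All using (All; []; _∷_)
import Data.List.Relation.Unary.All.Properties as All
open import Data.List.Relation.Unary.AllPairs as AllPairs using (AllPairs; []; _∷_)
import Data.List.Relation.Unary.AllPairs.Properties as AllPairs
open import Data.List.Relation.Unary.Any using (here; there)
open import Data.List.Relation.Unary.Unique.Propositional using (Unique)
import Data.List.Relation.Unary.Unique.Propositional.Properties as Unique
open import Data.Maybe as Maybe using (Maybe; just; nothing)
open import Data.Maybe.Properties using (just-injective)
open import Data.Nat using (ℕ; zero; suc; _+_; _∸_; _≤_; _<_; s≤s; z≤n; _<?_; _≤?_; _≟_)
open import Data.Nat.Properties
  using ( ≤-refl; ≤-reflexive; ≤-trans; ≤-antisym; <-trans; <⇒≤; ≮⇒≥; ≰⇒>; ≤∧≢⇒<; <-cmp; 1+n≰n; n≤1+n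
        ; m≤m+n; m≤n+m; m<m+n; m≤n⇒∃[o]m+o≡n; m+[n∸m]≡n; suc-injective
        ; +-assoc; +-comm; +-suc; +-identityʳ; +-mono-≤; +-monoˡ-≤; +-monoˡ-<
        ; +-cancelˡ-≤; +-cancelˡ-<; +-cancelʳ-≡)
open import Data.Nat.Tactic.RingSolver using (solve-∀)
open import Data.Product using (∃; _×_; _,_; proj₁; proj₂)
import Data.Product as Product
open import Data.Sum using (_⊎_; inj₁; inj₂)
import Data.Sum as Sum
open import Data.Unit using (⊤; tt)
open import Data.Vec as Vec using (Vec; []; _∷_; lookup)
import Data.Vec.Properties as Vec
open import Function using (id; _∘_; case_of_)
open import Function.Bundles using (_⇔_; mk⇔; Equivalence)
open import Relation.Binary using (tri<; tri≈; tri>)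
open import Relation.Binary.PropositionalEquality
  using (_≡_; _≢_; refl; sym; trans; cong; cong₂; subst; subst₂; module ≡-Reasoning)
open import Relation.Nullary using (¬_; yes; no; _×-dec_; _→-dec_)
open import Relation.Unary using (Decidable)

private
  variable
    A : Set
    b : Bool
    p q : Path

data Split {A : Set} : List A → ℕ → Set where
  split : ∀ xs ys → Split (xs ++ ys) (length xs)

data Split₃ {A : Set} (s : List A) (i ℓ : ℕ) : Set where
  split₃ : ∀ xs ys zs → s ≡ xs ++ ys ++ zs → length xs ≡ i → length ys ≡ ℓ → Split₃ s i ℓ

cut : ∀ (xs : List A) n → n ≤ length xs → Split xs n
cut xs       zero    _       = split [] xs
cut (x ∷ xs) (suc n) (s≤s h) with cut xs n h
... | split ys zs = split (x ∷ ys) zs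

cut₃ : ∀ (xs : List A) i ℓ → i + ℓ ≤ length xs → Split₃ xs i ℓ
cut₃ xs i ℓ h with cut xs i (≤-trans (m≤m+n i ℓ) h)
... | split ys rest with cut rest ℓ (+-cancelˡ-≤ (length ys) ℓ _ (subst (length ys + ℓ ≤_) (length-++ ys) h))
...   | split zs ws = split₃ ys zs ws refl refl refl

take-length-++ : ∀ (xs : List A) {ys} → take (length xs) (xs ++ ys) ≡ xs
take-length-++ []       = refl
take-length-++ (x ∷ xs) = cong (x ∷_) (take-length-++ xs)

drop-length-++ : ∀ (xs : List A) {ys} → drop (length xs) (xs ++ ys) ≡ ys
drop-length-++ []       = refl
drop-length-++ (x ∷ xs) = drop-length-++ xs

drop-length+-++ : ∀ (xs : List A) {ys} n → drop (length xs + n) (xs ++ ys) ≡ drop n ys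
drop-length+-++ []       n = refl
drop-length+-++ (x ∷ xs) n = drop-length+-++ xs n

++-assoc₃ : ∀ (xs ys zs : List A) ws → (xs ++ ys ++ zs) ++ ws ≡ xs ++ ys ++ zs ++ ws
++-assoc₃ xs ys zs ws = trans (++-assoc xs (ys ++ zs) ws) (cong (xs ++_) (++-assoc ys zs ws))

++-cancel-length : ∀ (xs ys : List A) {zs ws} → length xs ≡ length ys →
  xs ++ zs ≡ ys ++ ws → xs ≡ ys × zs ≡ ws
++-cancel-length []       []       _ e = refl , e
++-cancel-length (x ∷ xs) (y ∷ ys) l e with ∷-injective e
... | refl , e′ = Product.map₁ (cong (x ∷_)) (++-cancel-length xs ys (suc-injective l) e′)

allPairs-++⁻ : ∀ {R : A → A → Set} xs {ys} → AllPairs R (xs ++ ys) →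
  AllPairs R xs × AllPairs R ys × All (λ x → All (R x) ys) xs
allPairs-++⁻ []       Rys         = [] , Rys , []
allPairs-++⁻ (x ∷ xs) (Rx ∷ Rxys) with allPairs-++⁻ xs Rxys
... | Rxs , Rys , Rxsys = All.++⁻ˡ xs Rx ∷ Rxs , Rys , All.++⁻ʳ xs Rx ∷ Rxsys

nth : List A → ℕ → Maybe A
nth []       _       = nothing
nth (x ∷ xs) zero    = just x
nth (x ∷ xs) (suc n) = nth xs n

nth-++ʳ : ∀ (xs : List A) {ys} n → nth (xs ++ ys) (length xs + n) ≡ nth ys n
nth-++ʳ []       n = refl
nth-++ʳ (x ∷ xs) n = nth-++ʳ xs n

nth-++ˡ : ∀ (xs : List A) {ys n} → n < length xs → nth (xs ++ ys) n ≡ nth xs n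
nth-++ˡ (x ∷ xs) {n = zero}  _       = refl
nth-++ˡ (x ∷ xs) {n = suc n} (s≤s h) = nth-++ˡ xs h

nth-map : ∀ {B : Set} (f : A → B) xs n → nth (map f xs) n ≡ Maybe.map f (nth xs n)
nth-map f []       n       = refl
nth-map f (x ∷ xs) zero    = refl
nth-map f (x ∷ xs) (suc n) = nth-map f xs n

nth-just : ∀ (xs : List A) {n} → n < length xs → ∃ λ x → nth xs n ≡ just x
nth-just (x ∷ xs) {zero}  _       = x , refl
nth-just (x ∷ xs) {suc n} (s≤s h) = nth-just xs h

nth-nothing : ∀ (xs : List A) {n} → length xs ≤ n → nth xs n ≡ nothing
nth-nothing []       _       = refl
nth-nothing (x ∷ xs) (s≤s h) = nth-nothing xs h

nth-all : ∀ {P : A → Set} {xs n y} → All P xs → nth xs n ≡ just y → P y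
nth-all {xs = _ ∷ _} {zero}  (Px ∷ _)   refl = Px
nth-all {xs = _ ∷ _} {suc n} (_  ∷ Pxs) e    = nth-all Pxs e

nth-allPairs : ∀ {R : A → A → Set} {xs m n x y} → AllPairs R xs → m < n →
  nth xs m ≡ just x → nth xs n ≡ just y → R x y
nth-allPairs {xs = _ ∷ _} {zero}  {suc n} (Rx ∷ _)   _       refl e  = nth-all Rx e
nth-allPairs {xs = _ ∷ _} {suc m} {suc n} (_  ∷ Rxs) (s≤s h) e₁   e₂ = nth-allPairs Rxs h e₁ e₂

unique-map : ∀ {A B : Set} (f : A → B) {xs} → (∀ {x y} → x ∈ xs → y ∈ xs → f x ≡ f y → x ≡ y) →
  Unique xs → Unique (map f xs)
unique-map f {[]}     _   []               = []
unique-map f {x ∷ xs} inj (x∉xs ∷ unique) =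
  All.map⁺ (All.tabulate λ y∈xs fx≡fy → All.lookup x∉xs y∈xs (inj (here refl) (there y∈xs) fx≡fy))
  ∷ unique-map f (λ x∈ y∈ → inj (there x∈) (there y∈)) unique

HasCount-image : ∀ {A B : Set} {P : A → Set} {Q : B → Set} {k} (f : A → B) →
  (∀ {x y} → P x → P y → f x ≡ f y → x ≡ y) → (∀ y → Q y ⇔ ∃ λ x → P x × f x ≡ y) →
  HasCount P k → HasCount Q k
HasCount-image {Q = Q} f inj image (xs , unique , length≡ , members) =
    map f xs
  , unique-map f (λ x∈ y∈ → inj (member x∈) (member y∈)) unique
  , trans (length-map f xs) length≡
  , λ y → mk⇔ (to y) (from y)
  where
  member = λ {x} → Equivalence.to (members x)
  to : ∀ y → y ∈ map f xs → Q y
  to y y∈ with ∈-map⁻ f y∈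
  ... | x , x∈ , refl = Equivalence.from (image (f x)) (x , member x∈ , refl)
  from : ∀ y → Q y → y ∈ map f xs
  from y Qy with Equivalence.to (image y) Qy
  ... | x , Px , refl = ∈-map⁺ f (Equivalence.from (members x) Px)

HasCount-filter : ∀ {A : Set} {P : A → Set} (P? : Decidable P) (xs : List A) →
  Unique xs → (∀ {x} → P x → x ∈ xs) → HasCount P (length (filter P? xs))
HasCount-filter P? xs unique complete =
    filter P? xs
  , Unique.filter⁺ P? unique
  , refl
  , λ x → mk⇔ (proj₂ ∘ ∈-filter⁻ P? {xs = xs}) (λ Px → ∈-filter⁺ P? (complete Px) Px)

vecsBelow : ℕ → (k : ℕ) → List (Vec ℕ k)
vecsBelow b zero    = [ [] ]
vecsBelow b (suc k) = cartesianProductWith _∷_ (upTo b) (vecsBelow b k)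

vecsBelow-unique : ∀ b k → Unique (vecsBelow b k)
vecsBelow-unique b zero    = [] ∷ []
vecsBelow-unique b (suc k) =
  Unique.cartesianProductWith⁺ _∷_ Vec.∷-injective (Unique.upTo⁺ b) (vecsBelow-unique b k)

∈-vecsBelow : ∀ {b k} (v : Vec ℕ k) → (∀ i → lookup v i < b) → v ∈ vecsBelow b k
∈-vecsBelow []      _     = here refl
∈-vecsBelow (x ∷ v) below =
  ∈-cartesianProductWith⁺ _∷_ (∈-upTo⁺ (below Fin.zero)) (∈-vecsBelow v (below ∘ Fin.suc))

-- Leaf addresses

infix 4 _≼_ _∥_

_≼_ : Path → Path → Set
p ≼ q = ∃ λ r → p ++ r ≡ q

_∥_ : Path → Path → Set
p ∥ q = ¬ p ≼ q × ¬ q ≼ p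

Antichain : List Path → Set
Antichain = AllPairs _∥_

Separated : List Path → List Path → Set
Separated xs ys = All (λ x → All (x ∥_) ys) xs

∥-sym : p ∥ q → q ∥ p
∥-sym (p⋠q , q⋠p) = q⋠p , p⋠q

∥-irrefl : ¬ p ∥ p
∥-irrefl {p} (p⋠p , _) = p⋠p ([] , ++-identityʳ p)

¬[]∥ : ¬ [] ∥ q
¬[]∥ {q} ([]⋠q , _) = []⋠q (q , refl)

∷-≼ : p ≼ q → b ∷ p ≼ b ∷ q
∷-≼ (r , e) = r , cong (_ ∷_) e

∥-∷⁻ : b ∷ p ∥ b ∷ q → p ∥ q
∥-∷⁻ (p⋠q , q⋠p) = p⋠q ∘ ∷-≼ , q⋠p ∘ ∷-≼

prefixes-comparable : ∀ p q {r r′} → p ++ r ≡ q ++ r′ → p ≼ q ⊎ q ≼ p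
prefixes-comparable []      q       _ = inj₁ (q , refl)
prefixes-comparable (a ∷ p) []      _ = inj₂ (a ∷ p , refl)
prefixes-comparable (a ∷ p) (_ ∷ q) e with ∷-injective e
... | refl , e′ = Sum.map ∷-≼ ∷-≼ (prefixes-comparable p q e′)

∥-++ : ∀ t t′ → p ∥ q → p ++ t ∥ q ++ t′
∥-++ {p} {q} t t′ (p⋠q , q⋠p) =
    (λ (r , e) → comparable (prefixes-comparable p q (trans (sym (++-assoc p t r)) e)))
  , (λ (r , e) → comparable (prefixes-comparable p q (sym (trans (sym (++-assoc q t′ r)) e))))
  where
  comparable : p ≼ q ⊎ q ≼ p → ⊥
  comparable (inj₁ p≼q) = p⋠q p≼q
  comparable (inj₂ q≼p) = q⋠p q≼p

∥-++ʳ : ∀ t′ → p ∥ q → p ∥ q ++ t′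
∥-++ʳ {p} t′ p∥q = subst (_∥ _) (++-identityʳ p) (∥-++ [] t′ p∥q)

∥-++ˡ : ∀ t → p ∥ q → p ++ t ∥ q
∥-++ˡ t = ∥-sym ∘ ∥-++ʳ t ∘ ∥-sym

∷ʳ-≼ : ∀ {b b′} → p ∷ʳ b ≼ p ∷ʳ b′ → b ≡ b′
∷ʳ-≼ {p} {b} {b′} (r , e) =
  ∷-injectiveˡ (++-cancelˡ p (b ∷ r) [ b′ ] (trans (sym (++-assoc p [ b ] r)) e))

siblings-∥ : ∀ p → p ∷ʳ false ∥ p ∷ʳ true
siblings-∥ p = (λ h → case ∷ʳ-≼ h of λ ()) , (λ h → case ∷ʳ-≼ h of λ ())

grow-comm : ∀ t → p ∥ q → grow p (grow q t) ≡ grow q (grow p t)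
grow-comm {[]}        {q}         t          p∥q = case ¬[]∥ p∥q of λ ()
grow-comm {_ ∷ _}     {[]}        t          p∥q = case ¬[]∥ (∥-sym p∥q) of λ ()
grow-comm {_ ∷ _}     {_ ∷ _}     leaf       p∥q = refl
grow-comm {false ∷ p} {false ∷ q} (node l r) p∥q = cong (λ l′ → node l′ r) (grow-comm l (∥-∷⁻ p∥q))
grow-comm {false ∷ p} {true ∷ q}  (node l r) p∥q = refl
grow-comm {true ∷ p}  {false ∷ q} (node l r) p∥q = refl
grow-comm {true ∷ p}  {true ∷ q}  (node l r) p∥q = cong (node l) (grow-comm r (∥-∷⁻ p∥q))

foldr-grow-comm : ∀ t B → All (p ∥_) B → foldr grow (grow p t) B ≡ grow p (foldr grow t B)
foldr-grow-comm t []      []          = refl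
foldr-grow-comm t (q ∷ B) (p∥q ∷ p∥B) =
  trans (cong (grow q) (foldr-grow-comm t B p∥B)) (sym (grow-comm _ p∥q))

foldr-foldr-grow-comm : ∀ t B B′ → Separated B′ B →
  foldr grow (foldr grow t B) B′ ≡ foldr grow (foldr grow t B′) B
foldr-foldr-grow-comm t B []       []          = refl
foldr-foldr-grow-comm t B (p ∷ B′) (p∥B ∷ sep) =
  trans (cong (grow p) (foldr-foldr-grow-comm t B B′ sep)) (sym (foldr-grow-comm (foldr grow t B′) B p∥B))

leaves : DupState → List Path
leaves = proj₂

root : DupState
root = leaf , [ [] ]

children : Bool → List Path → List Path
children b = map (_∷ʳ b)

length-children : ∀ b B → length (children b B) ≡ length B
length-children b = length-map (_∷ʳ b)

duplicated : List Path → List Path → List Path → List Path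
duplicated X B Y = X ++ children false B ++ children true B ++ Y

dupLeaves : List Path → ℕ → ℕ → List Path
dupLeaves s i ℓ = duplicated (take i s) (take ℓ (drop i s)) (drop (i + ℓ) s)

duplicate : DupState → ℕ → ℕ → DupState
duplicate (t , s) i ℓ = foldr grow t (take ℓ (drop i s)) , dupLeaves s i ℓ

block-split₃ : ∀ (X B Y : List A) → take (length B) (drop (length X) (X ++ B ++ Y)) ≡ B
block-split₃ X B Y rewrite drop-length-++ X {B ++ Y} = take-length-++ B

dupLeaves-split₃ : ∀ X B Y → dupLeaves (X ++ B ++ Y) (length X) (length B) ≡ duplicated X B Y
dupLeaves-split₃ X B Y
  rewrite block-split₃ X B Y | take-length-++ X {B ++ Y}
        | drop-length+-++ X {B ++ Y} (length B) | drop-length-++ B {Y} = refl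

duplicate-split₃ : ∀ t {s} X B Y {i ℓ} → s ≡ X ++ B ++ Y → length X ≡ i → length B ≡ ℓ →
  duplicate (t , s) i ℓ ≡ (foldr grow t B , duplicated X B Y)
duplicate-split₃ t X B Y refl refl refl =
  cong₂ _,_ (cong (foldr grow t) (block-split₃ X B Y)) (dupLeaves-split₃ X B Y)

length-duplicated : ∀ X B Y → length (duplicated X B Y) ≡ length (X ++ B ++ Y) + length B
length-duplicated X B Y
  rewrite length-++ X {children false B ++ children true B ++ Y}
        | length-++ (children false B) {children true B ++ Y} | length-++ (children true B) {Y}
        | length-children false B | length-children true B | length-++ X {B ++ Y} | length-++ B {Y} =
  arithmetic (length X) (length B) (length Y)
  where
  arithmetic : ∀ x b y → x + (b + (b + y)) ≡ x + (b + y) + b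
  arithmetic = solve-∀

length-dupLeaves : ∀ s i ℓ → i + ℓ ≤ length s → length (dupLeaves s i ℓ) ≡ length s + ℓ
length-dupLeaves s i ℓ fits with cut₃ s i ℓ fits
... | split₃ X B Y refl refl refl rewrite dupLeaves-split₃ X B Y = length-duplicated X B Y

duplicated-++ : ∀ X B Y W → duplicated X B Y ++ W ≡ duplicated X B (Y ++ W)
duplicated-++ X B Y W =
  trans (++-assoc₃ X (children false B) (children true B ++ Y) W)
        (cong (λ r → X ++ children false B ++ r) (++-assoc (children true B) Y W))

duplicated-injective : ∀ X B Y X′ B′ Y′ → length X ≡ length X′ → length B ≡ length B′ →
  duplicated X B Y ≡ duplicated X′ B′ Y′ → X ++ B ++ Y ≡ X′ ++ B′ ++ Y′
duplicated-injective X B Y X′ B′ Y′ lX lB e with ++-cancel-length X X′ lX e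
... | refl , e₁ with ++-cancel-length (children false B) (children false B′) lengths e₁
  where
  lengths = trans (length-children false B) (trans lB (sym (length-children false B′)))
...   | lefts , e₂ with map-injective (∷ʳ-injectiveˡ _ _) lefts
...     | refl with ++-cancelˡ (children true B) Y Y′ e₂
...       | refl = refl

dupLeaves-injective : ∀ {s s′ i ℓ} → i + ℓ ≤ length s → i + ℓ ≤ length s′ →
  dupLeaves s i ℓ ≡ dupLeaves s′ i ℓ → s ≡ s′
dupLeaves-injective {s} {s′} {i} {ℓ} fits fits′ e with cut₃ s i ℓ fits | cut₃ s′ i ℓ fits′
... | split₃ X B Y refl refl refl | split₃ X′ B′ Y′ refl lX lB =
  duplicated-injective X B Y X′ B′ Y′ (sym lX) (sym lB)
    (trans (sym (dupLeaves-split₃ X B Y)) (trans e duplicated′))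
  where
  duplicated′ : dupLeaves (X′ ++ B′ ++ Y′) (length X) (length B) ≡ duplicated X′ B′ Y′
  duplicated′ rewrite sym lX | sym lB = dupLeaves-split₃ X′ B′ Y′

children-antichain : ∀ {B} b → Antichain B → Antichain (children b B)
children-antichain b = AllPairs.map⁺ ∘ AllPairs.map (∥-++ [ b ] [ b ])

∥-children : ∀ {B} b → All (p ∥_) B → All (p ∥_) (children b B)
∥-children b = All.map⁺ ∘ All.map (∥-++ʳ [ b ])

children-separated : ∀ {xs ys} b → Separated xs ys → Separated (children b xs) ys
children-separated b = All.map⁺ ∘ All.map (All.map (∥-++ˡ [ b ]))

siblings-separated : ∀ {B} → Antichain B → Separated (children false B) (children true B)
siblings-separated {[]}    []           = []
siblings-separated {b ∷ B} (b∥B ∷ anti) =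
    (siblings-∥ b ∷ All.map⁺ (All.map (∥-++ [ false ] [ true ]) b∥B))
  ∷ All.zipWith (λ (q∥b , q∥B) → q∥b ∷ q∥B)
      (All.map⁺ (All.map (∥-sym ∘ ∥-++ [ true ] [ false ]) b∥B) , siblings-separated anti)

antichain-duplicated : ∀ X B Y → Antichain (X ++ B ++ Y) → Antichain (duplicated X B Y)
antichain-duplicated X B Y anti with allPairs-++⁻ X anti
... | antiX , antiBY , X∥BY with allPairs-++⁻ B antiBY
...   | antiB , antiY , B∥Y =
  AllPairs.++⁺ antiX
    (AllPairs.++⁺ (children-antichain false antiB)
       (AllPairs.++⁺ (children-antichain true antiB) antiY (children-separated true B∥Y))
       (All.zipWith (λ (l , r) → All.++⁺ l r) (siblings-separated antiB , children-separated false B∥Y)))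
    (All.map ∥-duplicated X∥BY)
  where
  ∥-duplicated : All (p ∥_) (B ++ Y) → All (p ∥_) (children false B ++ children true B ++ Y)
  ∥-duplicated p∥BY =
    All.++⁺ (∥-children false (All.++⁻ˡ B p∥BY))
            (All.++⁺ (∥-children true (All.++⁻ˡ B p∥BY)) (All.++⁻ʳ B p∥BY))

antichain-dupLeaves : ∀ s i ℓ → i + ℓ ≤ length s → Antichain s → Antichain (dupLeaves s i ℓ)
antichain-dupLeaves s i ℓ fits anti with cut₃ s i ℓ fits
... | split₃ X B Y refl refl refl rewrite dupLeaves-split₃ X B Y = antichain-duplicated X B Y anti

reachable-antichain : ∀ {X} → Reachable X → Antichain (leaves X)
reachable-antichain start                      = [] ∷ []
reachable-antichain (dup {s = s} r i ℓ _ fits) = antichain-dupLeaves s i ℓ fits (reachable-antichain r)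

duplicate-comm : ∀ t s {i ℓ j ℓ′} → Antichain s → j + ℓ′ ≤ i → i + ℓ ≤ length s →
  duplicate (duplicate (t , s) i ℓ) j ℓ′ ≡ duplicate (duplicate (t , s) j ℓ′) (i + ℓ′) ℓ
duplicate-comm t s {i} {ℓ} {j} {ℓ′} anti left fits with cut₃ s i ℓ fits
... | split₃ W B Y refl refl refl with cut₃ W j ℓ′ left
...   | split₃ X B′ Z refl refl refl = begin
  duplicate (duplicate (t , s) i ℓ) j ℓ′
    ≡⟨ cong (λ S → duplicate S j ℓ′) (duplicate-split₃ t W B Y refl refl refl) ⟩
  duplicate (foldr grow t B , duplicated W B Y) j ℓ′
    ≡⟨ duplicate-split₃ _ X B′ (Z ++ doubledB) (++-assoc₃ X B′ Z _) refl refl ⟩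
  (foldr grow (foldr grow t B) B′ , duplicated X B′ (Z ++ doubledB))
    ≡⟨ cong₂ _,_ (foldr-foldr-grow-comm t B B′ B′∥B) (sym (duplicated-++ X B′ Z _)) ⟩
  (foldr grow (foldr grow t B′) B , duplicated (duplicated X B′ Z) B Y)
    ≡⟨ sym (duplicate-split₃ _ (duplicated X B′ Z) B Y
              (sym (duplicated-++ X B′ Z (B ++ Y))) (length-duplicated X B′ Z) refl) ⟩
  duplicate (foldr grow t B′ , duplicated X B′ (Z ++ B ++ Y)) (i + ℓ′) ℓ
    ≡⟨ cong (λ S → duplicate S (i + ℓ′) ℓ)
            (sym (duplicate-split₃ t X B′ (Z ++ B ++ Y) (++-assoc₃ X B′ Z _) refl refl)) ⟩
  duplicate (duplicate (t , s) j ℓ′) (i + ℓ′) ℓ ∎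
  where
  open ≡-Reasoning
  doubledB = children false B ++ children true B ++ Y
  B′∥B : Separated B′ B
  B′∥B with allPairs-++⁻ W anti
  ... | _ , _ , W∥BY = All.map (All.++⁻ˡ B) (All.++⁻ˡ B′ (All.++⁻ʳ X W∥BY))

-- Canonical histories

record Event : Set where
  constructor event
  field
    source : DupState
    offset : ℕ
    width  : ℕ
open Event

target : Event → DupState
target σ = duplicate (source σ) (offset σ) (width σ)

size : Event → ℕ
size σ = length (leaves (target σ))

initial : Event
initial = event root 0 1

-- Requiring offset σ < j + ℓ excludes a new block lying entirely to the left of the previous
-- one; such an event commutes with the previous one (duplicate-comm) and is moved before it.
data Canonical : Event → Set where
  first : Canonical initial
  next  : ∀ {σ} → Canonical σ → ∀ j ℓ → 1 ≤ ℓ → j + ℓ ≤ size σ → offset σ < j + ℓ →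
          Canonical (event (target σ) j ℓ)

canonical-reachable : ∀ {σ} → Canonical σ → Reachable (target σ)
canonical-reachable first                 = dup start 0 1 ≤-refl ≤-refl
canonical-reachable (next c j ℓ w fits _) = dup (canonical-reachable c) j ℓ w fits

canonical-width : ∀ {σ} → Canonical σ → 1 ≤ width σ
canonical-width first              = ≤-refl
canonical-width (next _ _ _ w _ _) = w

canonical-fits : ∀ {σ} → Canonical σ → offset σ + width σ ≤ length (leaves (source σ))
canonical-fits first                 = ≤-refl
canonical-fits (next _ _ _ _ fits _) = fits

size-canonical : ∀ {σ} → Canonical σ → size σ ≡ length (leaves (source σ)) + width σ
size-canonical {σ} c = length-dupLeaves _ (offset σ) (width σ) (canonical-fits c)

canonical-size : ∀ {σ} → Canonical σ → 2 ≤ size σ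
canonical-size first                      = ≤-refl
canonical-size (next {σ} c j ℓ w fits _) =
  ≤-trans (≤-trans (canonical-size c) (m≤m+n (size σ) ℓ)) (≤-reflexive (sym (length-dupLeaves _ j ℓ fits)))

canonical-extend : ∀ {σ} → Canonical σ → ∀ j ℓ → 1 ≤ ℓ → j + ℓ ≤ size σ →
  ∃ λ τ → Canonical τ × target τ ≡ duplicate (target σ) j ℓ ×
          (offset τ ≡ j ⊎ offset τ ≡ offset σ + ℓ)
canonical-extend {σ} c j ℓ w fits with offset σ <? j + ℓ
... | yes after = event (target σ) j ℓ , next c j ℓ w fits after , refl , inj₁ refl
canonical-extend first j ℓ w fits | no before = ⊥-elim (before (≤-trans w (m≤n+m ℓ j)))
-- A new block left of the last one is inserted before the last event, which then moves right by ℓ.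
canonical-extend (next {τ} c i ℓ₀ w₀ fits₀ after₀) j ℓ w fits | no before
  with ≮⇒≥ before
... | left with ≤-trans left (≤-trans (m≤m+n i ℓ₀) fits₀)
...   | fits-τ with canonical-extend c j ℓ w fits-τ
...     | τ′ , c′ , target-τ′ , offset-τ′ =
  event (target τ′) (i + ℓ) ℓ₀ , next c′ (i + ℓ) ℓ₀ w₀ fits′ (after′ offset-τ′) , target-eq , inj₂ refl
  where
  shift : ∀ m → m + ℓ₀ + ℓ ≡ m + ℓ + ℓ₀
  shift m = trans (+-assoc m ℓ₀ ℓ) (trans (cong (m +_) (+-comm ℓ₀ ℓ)) (sym (+-assoc m ℓ ℓ₀)))
  fits′ : i + ℓ + ℓ₀ ≤ size τ′
  fits′ = subst₂ _≤_ (shift i)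
            (sym (trans (cong (length ∘ leaves) target-τ′) (length-dupLeaves _ j ℓ fits-τ)))
            (+-monoˡ-≤ ℓ fits₀)
  after′ : offset τ′ ≡ j ⊎ offset τ′ ≡ offset τ + ℓ → offset τ′ < i + ℓ + ℓ₀
  after′ (inj₁ e) = subst (_< i + ℓ + ℓ₀) (sym e)
                      (≤-trans (m<m+n j w) (≤-trans left (≤-trans (m≤m+n i ℓ) (m≤m+n (i + ℓ) ℓ₀))))
  after′ (inj₂ e) = subst₂ _<_ (sym e) (shift i) (+-monoˡ-< ℓ after₀)
  target-eq : duplicate (target τ′) (i + ℓ) ℓ₀ ≡ duplicate (duplicate (target τ) i ℓ₀) j ℓ
  target-eq = trans (cong (λ X → duplicate X (i + ℓ) ℓ₀) target-τ′)
                    (sym (duplicate-comm _ _ (reachable-antichain (canonical-reachable c)) left fits₀))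

first-event : ∀ {i ℓ} → 1 ≤ ℓ → i + ℓ ≤ 1 → i ≡ 0 × ℓ ≡ 1
first-event {zero}  {suc zero}    _ _           = refl , refl
first-event {zero}  {suc (suc _)} _ (s≤s ())
first-event {suc i} {ℓ}           w (s≤s i+ℓ≤0) = case ≤-trans (≤-trans w (m≤n+m ℓ i)) i+ℓ≤0 of λ ()

reachable-canonical : ∀ {X} → Reachable X → X ≡ root ⊎ ∃ λ σ → Canonical σ × target σ ≡ X
reachable-canonical start = inj₁ refl
reachable-canonical (dup r i ℓ w fits) with reachable-canonical r
... | inj₁ refl with first-event w fits
...   | refl , refl = inj₂ (initial , first , refl)
reachable-canonical (dup r i ℓ w fits) | inj₂ (σ , c , refl) with canonical-extend c i ℓ w fits
... | τ , cτ , target-τ , _ = inj₂ (τ , cτ , target-τ)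

-- The last event of a canonical history

map-∷ʳ-just : ∀ {b} (mx : Maybe Path) {g} → Maybe.map (_∷ʳ b) mx ≡ just (g ∷ʳ b) → mx ≡ just g
map-∷ʳ-just (just x) {g} e = cong just (∷ʳ-injectiveˡ x g (just-injective e))

EndsAt : List Path → ℕ → Bool → Set
EndsAt L n b = ∃ λ g → nth L n ≡ just (g ∷ʳ b)

ends-unique : ∀ {L n} → EndsAt L n false → EndsAt L n true → ⊥
ends-unique (g , e) (h , e′) = case ∷ʳ-injectiveʳ g h (just-injective (trans (sym e) e′)) of λ ()

record DoubledAt (L : List Path) (p k : ℕ) : Set where
  constructor doubled
  field
    nonempty : 1 ≤ k
    pairs    : ∀ m → m < k →
               ∃ λ g → nth L (p + m) ≡ just (g ∷ʳ false) × nth L (p + k + m) ≡ just (g ∷ʳ true)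

  left : ∀ {m} → m < k → EndsAt L (p + m) false
  left m<k = let g , l , _ = pairs _ m<k in g , l

  right : ∀ {m} → m < k → EndsAt L (p + k + m) true
  right m<k = let g , _ , r = pairs _ m<k in g , r

doubledAt-≮-width : ∀ {L p k k′} → DoubledAt L p k → DoubledAt L p k′ → ¬ k < k′
doubledAt-≮-width {L} {p} {k} dbl dbl′ k<k′ =
  ends-unique {L} (DoubledAt.left dbl′ k<k′)
    (subst (λ n → EndsAt L n true) (+-identityʳ (p + k)) (DoubledAt.right dbl (DoubledAt.nonempty dbl)))

doubledAt-width : ∀ {L p k k′} → DoubledAt L p k → DoubledAt L p k′ → k ≡ k′
doubledAt-width {k = k} {k′} dbl dbl′ with <-cmp k k′
... | tri< k<k′ _ _ = ⊥-elim (doubledAt-≮-width dbl dbl′ k<k′)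
... | tri≈ _ k≡k′ _ = k≡k′
... | tri> _ _ k′<k = ⊥-elim (doubledAt-≮-width dbl′ dbl k′<k)

doubledAt-translate : ∀ {L L′ c c′ e k} → (∀ n → nth L (c + n) ≡ nth L′ (c′ + n)) →
  DoubledAt L (c + e) k → DoubledAt L′ (c′ + e) k
doubledAt-translate {L} {L′} {c} {c′} {e} {k} same (doubled w pairs) = doubled w λ m m<k →
  let g , l , r = pairs m m<k in
  g , moved (e + m) (+-assoc c e m) (+-assoc c′ e m) l , moved (e + k + m) (shift c m) (shift c′ m) r
  where
  shift : ∀ c m → c + e + k + m ≡ c + (e + k + m)
  shift c m = trans (+-assoc (c + e) k m) (trans (+-assoc c e (k + m)) (cong (c +_) (sym (+-assoc e k m))))
  moved : ∀ {x i i′} n → i ≡ c + n → i′ ≡ c′ + n → nth L i ≡ x → nth L′ i′ ≡ x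
  moved n refl refl e = trans (sym (same n)) e

module _ (X B Y : List Path) where

  private
    L = duplicated X B Y

  nth-left : ∀ {m} → m < length B → nth L (length X + m) ≡ Maybe.map (_∷ʳ false) (nth B m)
  nth-left {m} m<B = begin
    nth L (length X + m)                               ≡⟨ nth-++ʳ X m ⟩
    nth (children false B ++ children true B ++ Y) m   ≡⟨ nth-++ˡ (children false B) m<B′ ⟩
    nth (children false B) m                           ≡⟨ nth-map _ B m ⟩
    Maybe.map (_∷ʳ false) (nth B m)                    ∎
    where
    open ≡-Reasoning
    m<B′ = subst (m <_) (sym (length-children false B)) m<B

  nth-right : ∀ {m} → m < length B → nth L (length X + length B + m) ≡ Maybe.map (_∷ʳ true) (nth B m)
  nth-right {m} m<B = begin
    nth L (length X + length B + m)                 ≡⟨ cong (nth L) (+-assoc (length X) (length B) m) ⟩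
    nth L (length X + (length B + m))               ≡⟨ nth-++ʳ X (length B + m) ⟩
    nth (children false B ++ rights) (length B + m) ≡⟨ cong (λ n → nth (children false B ++ rights) (n + m))
                                                            (sym (length-children false B)) ⟩
    nth (children false B ++ rights) (length (children false B) + m) ≡⟨ nth-++ʳ (children false B) m ⟩
    nth rights m                                    ≡⟨ nth-++ˡ (children true B) m<B′ ⟩
    nth (children true B) m                         ≡⟨ nth-map _ B m ⟩
    Maybe.map (_∷ʳ true) (nth B m)                  ∎
    where
    open ≡-Reasoning
    rights = children true B ++ Y
    m<B′ = subst (m <_) (sym (length-children true B)) m<B

  nth-after : ∀ n → nth L (length X + length B + length B + n) ≡ nth (X ++ B ++ Y) (length X + length B + n)
  nth-after n = begin
    nth L (length X + length B + length B + n)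
      ≡⟨ cong (nth L) (positions (length-children false B) (length-children true B)) ⟩
    nth L (length X + (length (children false B) + (length (children true B) + n)))
      ≡⟨ trans (nth-++ʳ X _) (trans (nth-++ʳ (children false B) _) (nth-++ʳ (children true B) n)) ⟩
    nth Y n
      ≡⟨ sym (trans (nth-++ʳ X _) (nth-++ʳ B n)) ⟩
    nth (X ++ B ++ Y) (length X + (length B + n))
      ≡⟨ cong (nth (X ++ B ++ Y)) (sym (+-assoc (length X) (length B) n)) ⟩
    nth (X ++ B ++ Y) (length X + length B + n) ∎
    where
    open ≡-Reasoning
    positions : ∀ {l r} → l ≡ length B → r ≡ length B →
      length X + length B + length B + n ≡ length X + (l + (r + n))
    positions refl refl = trans (+-assoc (length X + length B) _ n) (+-assoc (length X) (length B) _)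

  ends-left : ∀ {m} → m < length B → EndsAt L (length X + m) false
  ends-left m<B = let g , e = nth-just B m<B in g , trans (nth-left m<B) (cong (Maybe.map _) e)

  ends-right : ∀ {m} → m < length B → EndsAt L (length X + length B + m) true
  ends-right m<B = let g , e = nth-just B m<B in g , trans (nth-right m<B) (cong (Maybe.map _) e)

  duplicated-doubledAt : 1 ≤ length B → DoubledAt L (length X) (length B)
  duplicated-doubledAt w = doubled w λ m m<B → let g , e = nth-just B m<B in
    g , trans (nth-left m<B) (cong (Maybe.map _) e) , trans (nth-right m<B) (cong (Maybe.map _) e)

  -- A block starting at offset d inside the left children either meets a left child where it
  -- needs a right one (d + k ≠ length B), or pairs B's entries d and 0, which differ in an antichain.
  ¬doubledAt-inside-left : Antichain B → ∀ {d k} → 0 < d → d < length B → ¬ DoubledAt L (length X + d) k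
  ¬doubledAt-inside-left anti {d} {k} 0<d d<B dbl with <-cmp (d + k) (length B)
  ... | tri< d+k<B _ _ =
    ends-unique {L} (subst (λ n → EndsAt L n false) (sym (+-assoc (length X) d k)) (ends-left d+k<B))
                    (subst (λ n → EndsAt L n true) (+-identityʳ _) (DoubledAt.right dbl (DoubledAt.nonempty dbl)))
  ... | tri> _ _ B<d+k with m≤n⇒∃[o]m+o≡n (<⇒≤ d<B)
  ...   | m , d+m≡B =
    ends-unique {L} (DoubledAt.left dbl m<k) (subst (λ n → EndsAt L n true) position (ends-right (<-trans 0<d d<B)))
    where
    m<k : m < k
    m<k = +-cancelˡ-< d m k (subst (_< d + k) (sym d+m≡B) B<d+k)
    position : length X + length B + 0 ≡ length X + d + m
    position = trans (+-identityʳ _) (trans (cong (length X +_) (sym d+m≡B)) (sym (+-assoc (length X) d m)))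
  ¬doubledAt-inside-left anti {d} {k} 0<d d<B dbl | tri≈ _ d+k≡B _ =
    ∥-irrefl (nth-allPairs anti 0<d B₀≡g B_d≡g)
    where
    open DoubledAt dbl
    g = proj₁ (pairs 0 nonempty)
    B_d≡g : nth B d ≡ just g
    B_d≡g = map-∷ʳ-just (nth B d) (trans (sym (nth-left d<B))
              (trans (cong (nth L) (sym (+-identityʳ _))) (proj₁ (proj₂ (pairs 0 nonempty)))))
    position : length X + length B + 0 ≡ length X + d + k + 0
    position = cong (_+ 0) (trans (cong (length X +_) (sym d+k≡B)) (sym (+-assoc (length X) d k)))
    B₀≡g : nth B 0 ≡ just g
    B₀≡g = map-∷ʳ-just (nth B 0) (trans (sym (nth-right (<-trans 0<d d<B)))
             (trans (cong (nth L) position) (proj₂ (proj₂ (pairs 0 nonempty)))))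

  ¬doubledAt-inside-right : ∀ {d k} → d < length B → ¬ DoubledAt L (length X + length B + d) k
  ¬doubledAt-inside-right d<B dbl =
    ends-unique {L} (subst (λ n → EndsAt L n false) (+-identityʳ _) (DoubledAt.left dbl (DoubledAt.nonempty dbl)))
                    (ends-right d<B)

  doubledAt-beyond : Antichain B → ∀ d {k} → 0 < d → DoubledAt L (length X + d) k →
    ∃ λ q → length X + length B ≤ q × DoubledAt (X ++ B ++ Y) q k
  doubledAt-beyond anti d {k} 0<d dbl with d <? length B
  ... | yes d<B = ⊥-elim (¬doubledAt-inside-left anti 0<d d<B dbl)
  ... | no d≮B with m≤n⇒∃[o]m+o≡n (≮⇒≥ d≮B)
  ...   | d′ , refl with d′ <? length B
  ...     | yes d′<B =
    ⊥-elim (¬doubledAt-inside-right d′<B (subst (λ p → DoubledAt L p k) (sym (+-assoc (length X) _ d′)) dbl))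
  ...     | no d′≮B with m≤n⇒∃[o]m+o≡n (≮⇒≥ d′≮B)
  ...       | e , refl =
    length X + length B + e , m≤m+n _ e ,
    doubledAt-translate nth-after (subst (λ p → DoubledAt L p k) position dbl)
    where
    position : length X + (length B + (length B + e)) ≡ length X + length B + length B + e
    position = sym (trans (+-assoc (length X + length B) (length B) e) (+-assoc (length X) (length B) (length B + e)))

dupLeaves-doubledAt : ∀ {s i ℓ} → 1 ≤ ℓ → i + ℓ ≤ length s → DoubledAt (dupLeaves s i ℓ) i ℓ
dupLeaves-doubledAt {s} {i} {ℓ} w fits with cut₃ s i ℓ fits
... | split₃ X B Y refl refl refl rewrite dupLeaves-split₃ X B Y = duplicated-doubledAt X B Y w

doubledAt-dupLeaves : ∀ {s i ℓ p k} → Antichain s → i + ℓ ≤ length s →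
  DoubledAt (dupLeaves s i ℓ) p k → i < p → ∃ λ q → i + ℓ ≤ q × DoubledAt s q k
doubledAt-dupLeaves {s} {i} {ℓ} {k = k} anti fits dbl i<p with cut₃ s i ℓ fits
... | split₃ X B Y refl refl refl with m≤n⇒∃[o]m+o≡n i<p
...   | d , refl = doubledAt-beyond X B Y antiB (suc d) (s≤s z≤n) dbl′
  where
  antiB : Antichain B
  antiB = proj₁ (allPairs-++⁻ B (proj₁ (proj₂ (allPairs-++⁻ X anti))))
  dbl′ : DoubledAt (duplicated X B Y) (length X + suc d) k
  dbl′ = subst₂ (λ L p → DoubledAt L p k) (dupLeaves-split₃ X B Y) (sym (+-suc (length X) d)) dbl

doubledAt-offset : ∀ {σ p k} → Canonical σ → DoubledAt (leaves (target σ)) p k → p ≤ offset σ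
doubledAt-offset {p = zero}      first _   = z≤n
doubledAt-offset {p = suc p} {k} first dbl =
  let g , e = DoubledAt.right dbl (DoubledAt.nonempty dbl) in
  case trans (sym (nth-nothing (leaves (target initial)) past-end)) e of λ ()
  where
  past-end : 2 ≤ suc p + k + 0
  past-end = s≤s (≤-trans (DoubledAt.nonempty dbl) (≤-trans (m≤n+m k p) (m≤m+n _ 0)))
doubledAt-offset {p = p} (next c j ℓ w fits after) dbl with p ≤? j
... | yes p≤j = p≤j
... | no p≰j with doubledAt-dupLeaves (reachable-antichain (canonical-reachable c)) fits dbl (≰⇒> p≰j)
...   | q , j+ℓ≤q , dbl′ = ⊥-elim (1+n≰n (≤-trans after (≤-trans j+ℓ≤q (doubledAt-offset c dbl′))))

size-next : ∀ {τ j ℓ} → Canonical τ → 1 ≤ ℓ → j + ℓ ≤ size τ → 3 ≤ size (event (target τ) j ℓ)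
size-next {j = j} {ℓ} c w fits =
  subst (3 ≤_) (sym (length-dupLeaves _ j ℓ fits)) (+-mono-≤ (canonical-size c) w)

canonical-injective : ∀ {σ τ} → Canonical σ → Canonical τ → leaves (target σ) ≡ leaves (target τ) → σ ≡ τ
canonical-injective first first _ = refl
canonical-injective first (next d j ℓ w fits _) e =
  case ≤-trans (size-next d w fits) (≤-reflexive (sym (cong length e))) of λ { (s≤s (s≤s ())) }
canonical-injective (next c j ℓ w fits _) first e =
  case ≤-trans (size-next c w fits) (≤-reflexive (cong length e)) of λ { (s≤s (s≤s ())) }
canonical-injective (next c i ℓ w fits after) (next d i′ ℓ′ w′ fits′ after′) e
  with dupLeaves-doubledAt w fits | dupLeaves-doubledAt w′ fits′
... | last | last′
  with ≤-antisym (doubledAt-offset (next d i′ ℓ′ w′ fits′ after′) (subst (λ L → DoubledAt L i ℓ) e last))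
                 (doubledAt-offset (next c i ℓ w fits after) (subst (λ L → DoubledAt L i′ ℓ′) (sym e) last′))
...   | refl with doubledAt-width last (subst (λ L → DoubledAt L i ℓ′) (sym e) last′)
...     | refl with canonical-injective c d (dupLeaves-injective {i = i} {ℓ} fits fits′ e)
...       | refl = refl

-- Reading a counter array as a history

event-≡ : ∀ {σ τ} → source σ ≡ source τ → offset σ ≡ offset τ → width σ ≡ width τ → σ ≡ τ
event-≡ refl refl refl = refl

-- An entry x is the 1-based start of the current block: repeating the current 0-based start
-- widens the block by one to the left, any other entry opens a new event of width 1.
-- Legal entries have 1 ≤ x, so x ∸ 1 is never truncated.
feed : Event → ℕ → Event
feed σ x with x ≟ offset σ
... | yes _ = event (source σ) (x ∸ 1) (suc (width σ))
... | no  _ = event (target σ) (x ∸ 1) 1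

feed-widen : ∀ {σ x} → x ≡ offset σ → feed σ x ≡ event (source σ) (x ∸ 1) (suc (width σ))
feed-widen {σ} {x} x≡i with x ≟ offset σ
... | yes _   = refl
... | no  x≢i = ⊥-elim (x≢i x≡i)

feed-open : ∀ {σ x} → x ≢ offset σ → feed σ x ≡ event (target σ) (x ∸ 1) 1
feed-open {σ} {x} x≢i with x ≟ offset σ
... | yes x≡i = ⊥-elim (x≢i x≡i)
... | no  _   = refl

Legal : Event → ℕ → Set
Legal σ x = offset σ ≤ x × 1 ≤ x × x ≤ size σ

feed-canonical : ∀ {σ x} → Canonical σ → Legal σ x → Canonical (feed σ x)
feed-canonical {σ} {x} c (i≤x , 1≤x , x≤size) with x ≟ offset σ
feed-canonical first (_ , () , _) | yes refl
feed-canonical (next {τ} c′ j ℓ w fits after) (_ , 1≤x , _) | yes refl =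
  next c′ (j ∸ 1) (suc ℓ) (s≤s z≤n)
    (subst (_≤ size τ) (sym (widened 1≤x)) fits) (subst (offset τ <_) (sym (widened 1≤x)) after)
  where
  widened : ∀ {j} → 1 ≤ j → j ∸ 1 + suc ℓ ≡ j + ℓ
  widened {suc j} _ = +-suc j ℓ
... | no x≢i =
  next c (x ∸ 1) 1 ≤-refl
    (subst (_≤ size σ) (sym opened) x≤size) (subst (offset σ <_) (sym opened) (≤∧≢⇒< i≤x (x≢i ∘ sym)))
  where
  opened : x ∸ 1 + 1 ≡ x
  opened = trans (+-comm (x ∸ 1) 1) (m+[n∸m]≡n 1≤x)

size-feed : ∀ {σ x} → Canonical σ → Legal σ x → size (feed σ x) ≡ suc (size σ)
size-feed {σ} {x} c legal with x ≟ offset σ | size-canonical (feed-canonical c legal)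
... | yes _ | size-fed = trans size-fed (trans (+-suc _ (width σ)) (cong suc (sym (size-canonical c))))
... | no  _ | size-fed = trans size-fed (+-comm (size σ) 1)

offset-feed : ∀ {σ x} → 1 ≤ x → suc (offset (feed σ x)) ≡ x
offset-feed {σ} {x} 1≤x with x ≟ offset σ
... | yes _ = m+[n∸m]≡n 1≤x
... | no  _ = m+[n∸m]≡n 1≤x

feed-injective : ∀ {σ τ x} → Canonical σ → Canonical τ → feed σ x ≡ feed τ x → σ ≡ τ
feed-injective {σ} {τ} {x} cσ cτ e with x ≟ offset σ | x ≟ offset τ
... | yes x≡i | yes x≡i′ = event-≡ (cong source e) (trans (sym x≡i) x≡i′) (suc-injective (cong width e))
... | no  _   | no  _    = canonical-injective cσ cτ (cong (leaves ∘ source) e)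
... | yes _   | no  _    = ⊥-elim (1+n≰n (≤-trans (canonical-width cσ) (≤-reflexive (suc-injective (cong width e)))))
... | no  _   | yes _    = ⊥-elim (1+n≰n (≤-trans (canonical-width cτ) (≤-reflexive (suc-injective (cong width (sym e))))))

run : ∀ {k} → Event → Vec ℕ k → Event
run σ []      = σ
run σ (x ∷ v) = run (feed σ x) v

Admissible : ∀ {k} → Event → Vec ℕ k → Set
Admissible σ []      = ⊤
Admissible σ (x ∷ v) = Legal σ x × Admissible (feed σ x) v

run-++ : ∀ {k l} σ (u : Vec ℕ k) (w : Vec ℕ l) → run σ (u Vec.++ w) ≡ run (run σ u) w
run-++ σ []      w = refl
run-++ σ (x ∷ u) w = run-++ (feed σ x) u w

admissible-++ : ∀ {k l σ} (u : Vec ℕ k) {w : Vec ℕ l} → Admissible σ u → Admissible (run σ u) w →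
  Admissible σ (u Vec.++ w)
admissible-++ []      _                      admissible-w = admissible-w
admissible-++ (x ∷ u) (legal , admissible-u) admissible-w = legal , admissible-++ u admissible-u admissible-w

run-canonical : ∀ {k σ} {v : Vec ℕ k} → Canonical σ → Admissible σ v → Canonical (run σ v)
run-canonical {v = []}    c _                    = c
run-canonical {v = x ∷ v} c (legal , admissible) = run-canonical (feed-canonical c legal) admissible

size-run : ∀ {k σ} {v : Vec ℕ k} → Canonical σ → Admissible σ v → size (run σ v) ≡ k + size σ
size-run {v = []}                c _                    = refl
size-run {suc k} {σ} {v = x ∷ v} c (legal , admissible) =
  trans (size-run (feed-canonical c legal) admissible) (trans (cong (k +_) (size-feed c legal)) (+-suc k (size σ)))

run-injective : ∀ {k σ τ} (v w : Vec ℕ k) → Canonical σ → Canonical τ → Admissible σ v → Admissible τ w →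
  run σ v ≡ run τ w → σ ≡ τ × v ≡ w
run-injective []      []      _  _  _ _ e = e , refl
run-injective (x ∷ v) (y ∷ w) cσ cτ (legal-x@(_ , 1≤x , _) , admissible-v)
                                    (legal-y@(_ , 1≤y , _) , admissible-w) e
  with run-injective v w (feed-canonical cσ legal-x) (feed-canonical cτ legal-y) admissible-v admissible-w e
... | fed , refl with trans (sym (offset-feed 1≤x)) (trans (cong (suc ∘ offset) fed) (offset-feed 1≤y))
...   | refl = feed-injective cσ cτ fed , refl

descending : ℕ → (ℓ : ℕ) → Vec ℕ ℓ
descending j zero    = []
descending j (suc ℓ) = suc (j + ℓ) ∷ descending j ℓ

run-widen : ∀ X j ℓ w → run (event X (j + ℓ) w) (descending j ℓ) ≡ event X j (w + ℓ)
run-widen X j zero    w rewrite +-identityʳ j | +-identityʳ w = refl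
run-widen X j (suc ℓ) w rewrite feed-widen {event X (j + suc ℓ) w} (sym (+-suc j ℓ)) | run-widen X j ℓ (suc w) =
  cong (event X j) (sym (+-suc w ℓ))

run-descending : ∀ {σ} j ℓ → 1 ≤ ℓ → offset σ < j + ℓ → run σ (descending j ℓ) ≡ event (target σ) j ℓ
run-descending {σ} j (suc ℓ) _ after
  rewrite feed-open {σ} (λ e → 1+n≰n (≤-trans after (≤-reflexive (trans (+-suc j ℓ) e)))) =
  run-widen (target σ) j ℓ 1

-- CounterFrom c q v: v can follow c entries of a counter array whose last entry is q (q = 0 if c = 0).
CounterFrom : ∀ {k} → ℕ → ℕ → Vec ℕ k → Set
CounterFrom c q []      = ⊤
CounterFrom c q (x ∷ v) = (q ≤ suc x × 1 ≤ x × x ≤ suc c) × CounterFrom (suc c) x v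

counterFrom⇔admissible : ∀ {k σ c q} (v : Vec ℕ k) → Canonical σ → size σ ≡ suc c → q ≡ suc (offset σ) →
  CounterFrom c q v ⇔ Admissible σ v
counterFrom⇔admissible []                 _  _     _    = mk⇔ id id
counterFrom⇔admissible {σ = σ} {c} (x ∷ v) cσ size≡ refl = mk⇔
  (λ (entry , counter) → legal entry , Equivalence.to (rest (legal entry)) counter)
  (λ (l , admissible) → entry l , Equivalence.from (rest l) admissible)
  where
  legal : suc (offset σ) ≤ suc x × 1 ≤ x × x ≤ suc c → Legal σ x
  legal (s≤s i≤x , 1≤x , x≤c) = i≤x , 1≤x , subst (x ≤_) (sym size≡) x≤c
  entry : Legal σ x → suc (offset σ) ≤ suc x × 1 ≤ x × x ≤ suc c
  entry (i≤x , 1≤x , x≤size) = s≤s i≤x , 1≤x , subst (x ≤_) size≡ x≤size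
  rest : Legal σ x → CounterFrom (suc c) x v ⇔ Admissible (feed σ x) v
  rest l@(_ , 1≤x , _) =
    counterFrom⇔admissible v (feed-canonical cσ l) (trans (size-feed cσ l) (cong suc size≡))
                             (sym (offset-feed 1≤x))

counterFrom-descending : ∀ {c q} j ℓ → q ≤ suc (j + ℓ) → j + ℓ ≤ suc c → CounterFrom c q (descending j ℓ)
counterFrom-descending j zero    _  _    = tt
counterFrom-descending j (suc ℓ) q≤ fits rewrite +-suc j ℓ =
  (q≤ , s≤s z≤n , fits) , counterFrom-descending j ℓ ≤-refl (≤-trans (n≤1+n _) (≤-trans fits (n≤1+n _)))

admissible-descending : ∀ {σ j ℓ} → Canonical σ → j + ℓ ≤ size σ → offset σ < j + ℓ →
  Admissible σ (descending j ℓ)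
admissible-descending {σ} {j} {ℓ} c fits after with m≤n⇒∃[o]m+o≡n (≤-trans (s≤s z≤n) (canonical-size c))
... | c′ , size≡ = Equivalence.to (counterFrom⇔admissible _ c (sym size≡) refl)
                     (counterFrom-descending j ℓ (≤-trans after (n≤1+n _)) (subst (j + ℓ ≤_) (sym size≡) fits))

canonical-array : ∀ {σ} → Canonical σ →
  ∃ λ k → ∃ λ (v : Vec ℕ k) → Admissible initial v × run initial v ≡ σ
canonical-array first = 0 , [] , tt , refl
canonical-array (next c j ℓ w fits after) with canonical-array c
... | k , v , admissible , refl =
    k + ℓ
  , v Vec.++ descending j ℓ
  , admissible-++ v admissible (admissible-descending c fits after)
  , trans (run-++ initial v _) (run-descending j ℓ w after)

-- IsCounterArray n a unfolds to Bounded 0 a × Chained a.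
Bounded : ∀ {k} → ℕ → Vec ℕ k → Set
Bounded c a = ∀ i → 1 ≤ lookup a i × lookup a i ≤ c + suc (toℕ i)

Chained : ∀ {k} → Vec ℕ k → Set
Chained a = ∀ i j → toℕ j ≡ suc (toℕ i) → lookup a i ≤ suc (lookup a j)

Follows : ∀ {k} → ℕ → Vec ℕ k → Set
Follows q []      = ⊤
Follows q (x ∷ _) = q ≤ suc x

bounded-∷ : ∀ {k c x} {v : Vec ℕ k} → Bounded c (x ∷ v) ⇔ ((1 ≤ x × x ≤ suc c) × Bounded (suc c) v)
bounded-∷ {c = c} {x} {v} = mk⇔
  (λ bnd → (proj₁ (bnd Fin.zero) , subst (x ≤_) (+-comm c 1) (proj₂ (bnd Fin.zero)))
         , λ i → Product.map₂ (subst (lookup v i ≤_) (+-suc c (suc (toℕ i)))) (bnd (Fin.suc i)))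
  (λ ((1≤x , x≤) , bnd) → λ where
     Fin.zero    → 1≤x , subst (x ≤_) (+-comm 1 c) x≤
     (Fin.suc i) → Product.map₂ (subst (lookup v i ≤_) (sym (+-suc c (suc (toℕ i))))) (bnd i))

chained-∷ : ∀ {k x} {v : Vec ℕ k} → Chained (x ∷ v) ⇔ (Follows x v × Chained v)
chained-∷ {x = x} {v} = mk⇔
  (λ ch → follows v ch , λ i j e → ch (Fin.suc i) (Fin.suc j) (cong suc e))
  (λ (fol , ch) → λ where
     Fin.zero    (Fin.suc j) e → head-follows v fol j (suc-injective e)
     (Fin.suc i) (Fin.suc j) e → ch i j (suc-injective e))
  where
  follows : ∀ {k} (v : Vec ℕ k) → Chained (x ∷ v) → Follows x v
  follows []      _  = tt
  follows (_ ∷ _) ch = ch Fin.zero (Fin.suc Fin.zero) refl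
  head-follows : ∀ {k} (v : Vec ℕ k) → Follows x v → ∀ j → toℕ j ≡ 0 → x ≤ suc (lookup v j)
  head-follows (_ ∷ _) fol Fin.zero _ = fol

counterFrom⇔ : ∀ {k} c q (a : Vec ℕ k) → (Bounded c a × Chained a × Follows q a) ⇔ CounterFrom c q a
counterFrom⇔ c q []      = mk⇔ (λ _ → tt) (λ _ → (λ ()) , (λ ()) , tt)
counterFrom⇔ c q (x ∷ v) = mk⇔
  (λ (bnd , ch , q≤) →
     let (1≤x , x≤) , bnd′ = Equivalence.to bounded-∷ bnd
         fol , ch′         = Equivalence.to chained-∷ ch
     in (q≤ , 1≤x , x≤) , Equivalence.to (counterFrom⇔ (suc c) x v) (bnd′ , ch′ , fol))
  (λ ((q≤ , 1≤x , x≤) , counter) →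
     let bnd′ , ch′ , fol = Equivalence.from (counterFrom⇔ (suc c) x v) counter
     in Equivalence.from bounded-∷ ((1≤x , x≤) , bnd′) , Equivalence.from chained-∷ (fol , ch′) , q≤)

counterArray⇔ : ∀ {n} (a : Vec ℕ n) → IsCounterArray n a ⇔ CounterFrom 0 0 a
counterArray⇔ a = mk⇔
  (λ (bnd , ch) → Equivalence.to (counterFrom⇔ 0 0 a) (bnd , ch , follows-0 a))
  (λ counter → let bnd , ch , _ = Equivalence.from (counterFrom⇔ 0 0 a) counter in bnd , ch)
  where
  follows-0 : ∀ {k} (a : Vec ℕ k) → Follows 0 a
  follows-0 []      = tt
  follows-0 (_ ∷ _) = z≤n

counterArray-∷⇔ : ∀ {n x} (w : Vec ℕ n) →
  IsCounterArray (suc n) (x ∷ w) ⇔ (x ≡ 1 × Admissible initial w)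
counterArray-∷⇔ {x = x} w = mk⇔
  (λ ca → let (_ , 1≤x , x≤1) , counter = Equivalence.to (counterArray⇔ (x ∷ w)) ca
              x≡1 = ≤-antisym x≤1 1≤x
          in x≡1 , Equivalence.to tail⇔ (subst (λ q → CounterFrom 1 q w) x≡1 counter))
  (λ (x≡1 , admissible) → Equivalence.from (counterArray⇔ (x ∷ w))
      ( (z≤n , subst (1 ≤_) (sym x≡1) ≤-refl , subst (_≤ 1) (sym x≡1) ≤-refl)
      , subst (λ q → CounterFrom 1 q w) (sym x≡1) (Equivalence.from tail⇔ admissible)))
  where
  tail⇔ : CounterFrom 1 1 w ⇔ Admissible initial w
  tail⇔ = counterFrom⇔admissible w first refl refl

counterArray? : ∀ n → Decidable (IsCounterArray n)
counterArray? n a =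
  all? (λ i → (1 ≤? lookup a i) ×-dec (lookup a i ≤? suc (toℕ i))) ×-dec
  all? (λ i → all? λ j → (toℕ j ≟ suc (toℕ i)) →-dec (lookup a i ≤? suc (lookup a j)))

counterArray-< : ∀ {n a} → IsCounterArray n a → ∀ i → lookup a i < suc n
counterArray-< (bounded , _) i = s≤s (≤-trans (proj₂ (bounded i)) (toℕ<n i))

counterArrays : ∀ n → HasCount (IsCounterArray n) (length (filter (counterArray? n) (vecsBelow (suc n) n)))
counterArrays n =
  HasCount-filter (counterArray? n) _ (vecsBelow-unique (suc n) n)
    (λ {a} ca → ∈-vecsBelow a (counterArray-< {a = a} ca))

-- The first entry of a counter array is always 1; it records the first event, which duplicates the root.
arrayTree : ∀ {n} → Vec ℕ n → DupState
arrayTree []      = root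
arrayTree (_ ∷ w) = target (run initial w)

arrayTree-injective : ∀ {n} {a b : Vec ℕ n} → IsCounterArray n a → IsCounterArray n b →
  arrayTree a ≡ arrayTree b → a ≡ b
arrayTree-injective {a = []}    {[]}    _ _ _ = refl
arrayTree-injective {a = x ∷ v} {y ∷ w} ca cb e
  with Equivalence.to (counterArray-∷⇔ v) ca | Equivalence.to (counterArray-∷⇔ w) cb
... | refl , admissible-v | refl , admissible-w
  with run-injective v w first first admissible-v admissible-w
         (canonical-injective (run-canonical first admissible-v) (run-canonical first admissible-w) (cong leaves e))
...   | _ , refl = refl

rooted⇔arrayTree : ∀ {n} → 1 ≤ n → ∀ X →
  IsRootedDupTree (suc n) X ⇔ ∃ λ a → IsCounterArray n a × arrayTree a ≡ X
rooted⇔arrayTree {suc m} _ X = mk⇔ to from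
  where
  to : IsRootedDupTree (suc (suc m)) X → ∃ λ a → IsCounterArray (suc m) a × arrayTree a ≡ X
  to (reachable , length≡) with reachable-canonical reachable
  ... | inj₁ refl = case length≡ of λ ()
  ... | inj₂ (σ , c , refl) with canonical-array c
  ...   | k , v , admissible , refl
    with +-cancelʳ-≡ 2 k m (trans (sym (size-run first admissible)) (trans length≡ (+-comm 2 m)))
  ...     | refl = 1 ∷ v , Equivalence.from (counterArray-∷⇔ v) (refl , admissible) , refl
  from : (∃ λ a → IsCounterArray (suc m) a × arrayTree a ≡ X) → IsRootedDupTree (suc (suc m)) X
  from (x ∷ w , ca , refl) with Equivalence.to (counterArray-∷⇔ w) ca
  ... | _ , admissible =
    canonical-reachable (run-canonical first admissible) , trans (size-run first admissible) (+-comm m 2)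

lemma4 : (n : ℕ) → 1 ≤ n →
    ∃ λ k → HasCount (IsRootedDupTree (suc n)) k × HasCount (IsCounterArray n) k
lemma4 n 1≤n =
  _ , HasCount-image arrayTree arrayTree-injective (rooted⇔arrayTree 1≤n) (counterArrays n) , counterArrays n
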